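{- Let $M$ be a $0/\pm1$ matrix and $M^t$ its transpose. Then the posets $(\mathrm{Part}(M^t),\preceq)$ and $(\mathrm{Part}(M),\preceq)$ are isomorphic.
   Context: For a matrix $P$ and integers $a\le b$, $c\le d$, $P_{[a,b)\times[c,d)}$ denotes the (possibly empty) submatrix of rows $a,\dots,b-1$ and columns $c,\dots,d-1$. A submatrix of a permutation matrix is increasing if its nonzero entries, listed in order of increasing row index, have strictly increasing column indices, and decreasing if strictly decreasing (a zero or empty submatrix is both). For an $r\times s$ matrix $M$ with entries in $\{0,1,-1\}$ and an $n\times n$ permutation matrix $P$, an $M$-partition of $P$ is a pair of multisets $I=\{1=i_1\le\dots\le i_{r+1}=n+1\}$, $J=\{1=j_1\le\dots\le j_{s+1}=n+1\}$ such that for all $k\in[r]$, $\ell\in[s]$: $P_{[i_k,i_{k+1})\times[j_\ell,j_{\ell+1})}$ is zero if $M_{k,\ell}=0$, increasing if $M_{k,\ell}=1$, decreasing if $M_{k,\ell}=-1$. $\mathrm{Part}(M)$ is the set of triples $(P,I,J)$ with $P$ a permutation matrix and $(I,J)$ an $M$-partition of $P$. For a matrix $P$, $\mathrm{supp}(P)$ is the set of positions of nonzero entries; for a finite set $X$ of positions, $\Delta(X)$ is the smallest $0/1$ matrix with support $X$, and $\mathrm{red}(Q)$ is the matrix obtained from $Q$ by deleting all all-zero rows and columns. For $(P,I,J),(P',I',J')\in\mathrm{Part}(M)$ with $I=\{i_1\le\dots\le i_{r+1}\}$, $J=\{j_1\le\dots\le j_{s+1}\}$, $I'=\{i'_1\le\dots\le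 i'_{r+1}\}$, $J'=\{j'_1\le\dots\le j'_{s+1}\}$, write $(P',I',J')\preceq(P,I,J)$ if there is $X\subseteq\mathrm{supp}(P)$ with $\mathrm{red}(\Delta(X))=P'$ and, for all $k\in[r],\ell\in[s]$, $|X\cap([i_k,i_{k+1})\times[j_\ell,j_{\ell+1}))|=|\mathrm{supp}(P')\cap([i'_k,i'_{k+1})\times[j'_\ell,j'_{\ell+1}))|$. This $\preceq$ is a partial order on $\mathrm{Part}(M)$. -}

module Defs where

open import Data.Nat using (ℕ; zero; suc; _≤_; _<_; _≤ᵇ_; _<ᵇ_; _≡ᵇ_; _⊔_)
open import Data.Bool using (Bool; true; false; _∧_)
open import Data.Fin using (Fin; inject₁; fromℕ) renaming (zero to fzero; suc to fsuc)
open import Data.Vec using (Vec; lookup)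
open import Data.List using (List; []; _∷_; length; upTo; filterᵇ; foldr; cartesianProduct)
open import Data.Bool.ListAction using (any)
open import Data.List.Membership.Propositional using (_∈_)
open import Data.List.Relation.Unary.All using (All)
open import Data.List.Relation.Unary.Unique.Propositional using (Unique)
open import Data.Product using (Σ; _×_; _,_; proj₁; proj₂)
open import Relation.Binary.PropositionalEquality using (_≡_)

data Sign : Set where
  s0 s+ s- : Sign

SMat : ℕ → ℕ → Set
SMat r s = Fin r → Fin s → Sign

transpose : ∀ {r s} → SMat r s → SMat s r
transpose M ℓ k = M k ℓ

-- 0/1 matrices; indices are 0-based (row a of the paper = a-1 here).
-- Entries outside [0,nr) × [0,nc) are irrelevant.
record Mat : Set where
  constructor mat
  field
    nr nc : ℕ
    ent : ℕ → ℕ → Bool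
open Mat public

_≋_ : Mat → Mat → Set
A ≋ B = nr A ≡ nr B × nc A ≡ nc B
      × (∀ a b → a < nr A → b < nc A → ent A a b ≡ ent B a b)

Pos : Set
Pos = ℕ × ℕ

_==ᵖ_ : Pos → Pos → Bool
(a , b) ==ᵖ (c , d) = (a ≡ᵇ c) ∧ (b ≡ᵇ d)

-- Δ(X): smallest 0/1 matrix with support X (X a finite set, as a list)
Δ : List Pos → Mat
Δ X = mat (foldr (λ p m → suc (proj₁ p) ⊔ m) 0 X)
          (foldr (λ p m → suc (proj₂ p) ⊔ m) 0 X)
          (λ a b → any (λ p → p ==ᵖ (a , b)) X)

-- default-0 list indexing
nth : List ℕ → ℕ → ℕ
nth []       _       = 0
nth (x ∷ xs) zero    = x
nth (x ∷ xs) (suc i) = nth xs i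

nonzeroRow : Mat → ℕ → Bool
nonzeroRow Q a = any (λ b → ent Q a b) (upTo (nc Q))

nonzeroCol : Mat → ℕ → Bool
nonzeroCol Q b = any (λ a → ent Q a b) (upTo (nr Q))

red : Mat → Mat
red Q = mat (length R) (length C) (λ i j → ent Q (nth R i) (nth C j))
  where
  R = filterᵇ (nonzeroRow Q) (upTo (nr Q))
  C = filterᵇ (nonzeroCol Q) (upTo (nc Q))

supp : Mat → List Pos
supp P = filterᵇ (λ p → ent P (proj₁ p) (proj₂ p))
                 (cartesianProduct (upTo (nr P)) (upTo (nc P)))

ExactlyOne : ℕ → (ℕ → Bool) → Set
ExactlyOne n f = Σ ℕ λ b → b < n × f b ≡ true × (∀ c → c < n → f c ≡ true → c ≡ b)

IsPerm : Mat → Set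
IsPerm P = nr P ≡ nc P
         × (∀ a → a < nr P → ExactlyOne (nc P) (λ b → ent P a b))
         × (∀ b → b < nc P → ExactlyOne (nr P) (λ a → ent P a b))

-- multisets {0 = i_0 ≤ ... ≤ i_r = n} (0-based version of 1 = i_1 ≤ ... ≤ i_{r+1} = n+1)
IsBreaks : (r n : ℕ) → Vec ℕ (suc r) → Set
IsBreaks r n I = lookup I fzero ≡ 0 × lookup I (fromℕ r) ≡ n
               × (∀ (k : Fin r) → lookup I (inject₁ k) ≤ lookup I (fsuc k))

BlockOK : Sign → Mat → (i i' j j' : ℕ) → Set
BlockOK s0 P i i' j j' =
  ∀ a b → i ≤ a → a < i' → j ≤ b → b < j' → ent P a b ≡ false
BlockOK s+ P i i' j j' =
  ∀ a b a' b' → i ≤ a → a < i' → j ≤ b → b < j' → i ≤ a' → a' < i' → j ≤ b' → b' < j' →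
  a < a' → ent P a b ≡ true → ent P a' b' ≡ true → b < b'
BlockOK s- P i i' j j' =
  ∀ a b a' b' → i ≤ a → a < i' → j ≤ b → b < j' → i ≤ a' → a' < i' → j ≤ b' → b' < j' →
  a < a' → ent P a b ≡ true → ent P a' b' ≡ true → b' < b

IsMPartition : ∀ {r s} → SMat r s → Mat → Vec ℕ (suc r) → Vec ℕ (suc s) → Set
IsMPartition {r} {s} M P I J =
  ∀ (k : Fin r) (ℓ : Fin s) →
    BlockOK (M k ℓ) P (lookup I (inject₁ k)) (lookup I (fsuc k))
                      (lookup J (inject₁ ℓ)) (lookup J (fsuc ℓ))

record Part {r s : ℕ} (M : SMat r s) : Set where
  constructor part
  field
    P     : Mat
    Pperm : IsPerm P
    I     : Vec ℕ (suc r)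
    J     : Vec ℕ (suc s)
    Iok   : IsBreaks r (nr P) I
    Jok   : IsBreaks s (nr P) J
    Mok   : IsMPartition M P I J
open Part public

_≈ₚ_ : ∀ {r s} {M : SMat r s} → Part M → Part M → Set
x ≈ₚ y = P x ≋ P y × I x ≡ I y × J x ≡ J y

countIn : (i i' j j' : ℕ) → List Pos → ℕ
countIn i i' j j' L =
  length (filterᵇ (λ p → (i ≤ᵇ proj₁ p) ∧ (proj₁ p <ᵇ i') ∧ (j ≤ᵇ proj₂ p) ∧ (proj₂ p <ᵇ j')) L)

_≼_ : ∀ {r s} {M : SMat r s} → Part M → Part M → Set
_≼_ {r} {s} y x =
  Σ (List Pos) λ X →
    Unique X × All (_∈ supp (P x)) X × (red (Δ X) ≋ P y)
    × (∀ (k : Fin r) (ℓ : Fin s) →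
         countIn (lookup (I x) (inject₁ k)) (lookup (I x) (fsuc k))
                 (lookup (J x) (inject₁ ℓ)) (lookup (J x) (fsuc ℓ)) X
       ≡ countIn (lookup (I y) (inject₁ k)) (lookup (I y) (fsuc k))
                 (lookup (J y) (inject₁ ℓ)) (lookup (J y) (fsuc ℓ)) (supp (P y)))

record OrderIso {A B : Set} (_≈A_ _≤A_ : A → A → Set) (_≈B_ _≤B_ : B → B → Set) : Set where
  field
    to       : A → B
    from     : B → A
    to-cong  : ∀ {x y} → x ≈A y → to x ≈B to y
    from-cong : ∀ {x y} → x ≈B y → from x ≈A from y
    from-to  : ∀ x → from (to x) ≈A x
    to-from  : ∀ y → to (from y) ≈B y
    to-mono  : ∀ x y → x ≤A y → to x ≤B to y
    to-refl  : ∀ x y → to x ≤B to y → x ≤A y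

-- Transposition (P, I, J) ↦ (Pᵗ, J, I) is an involution from Part(Mᵗ) to Part(M):
-- a block of a permutation matrix is increasing (decreasing) iff its transpose is,
-- because no two nonzero entries share a row or a column. It preserves ≼ since a
-- witness X for y ≼ x transposes to the witness obtained by swapping every position:
-- red ∘ Δ commutes with transposition, and block counts are unchanged when both the
-- positions and the block are transposed.
module Submission where

open import Defs
open import Data.Nat using (ℕ; suc; _≤_; _<_; _≤ᵇ_; _<ᵇ_; _≡ᵇ_; _+_; _⊔_)
open import Data.Nat.Properties
  using (≤-refl; ≤-trans; <-≤-trans; <-cmp; <-irrefl; <-asym; +-commutativeSemigroup)
open import Algebra.Properties.CommutativeSemigroup +-commutativeSemigroup using (interchange)
open import Data.Bool using (Bool; true; false; _∧_; _∨_)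
open import Data.Bool.Properties using (∧-assoc; ∧-comm)
open import Data.Bool.ListAction using (any; or)
open import Data.Fin using (Fin; inject₁; fromℕ) renaming (zero to fzero; suc to fsuc)
open import Data.Vec using (Vec; lookup; _∷_; [])
open import Data.List using (List; []; _∷_; [_]; length; upTo; filterᵇ; cartesianProduct; map; _++_)
open import Data.List.Properties using (length-++; filter-++; map-cong; cartesianProductWith-zeroʳ)
open import Data.List.Membership.Propositional using (_∈_)
open import Data.List.Membership.Propositional.Properties
  using (∈-filter⁺; ∈-filter⁻; ∈-cartesianProduct⁺; ∈-cartesianProduct⁻)
open import Data.List.Relation.Unary.Unique.Propositional.Properties using (map⁺)
import Data.List.Relation.Unary.All as All
import Data.List.Relation.Unary.All.Properties as All
open import Data.Product using (_×_; _,_; proj₁; proj₂; swap)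
open import Data.Empty using (⊥-elim)
open import Function using (_∘_)
open import Relation.Binary.Definitions using (tri<; tri≈; tri>)
open import Relation.Binary.PropositionalEquality
  using (_≡_; _≗_; refl; sym; trans; cong; cong₂; subst; module ≡-Reasoning)
open import Relation.Nullary.Decidable using (T?)

infix 30 _ᵗ

_ᵗ : Mat → Mat
P ᵗ = mat (nc P) (nr P) (λ a b → ent P b a)

≋-refl : ∀ {A} → A ≋ A
≋-refl = refl , refl , λ _ _ _ _ → refl

≋-trans : ∀ {A B C} → A ≋ B → B ≋ C → A ≋ C
≋-trans (r₁ , c₁ , e₁) (r₂ , c₂ , e₂) =
  trans r₁ r₂ , trans c₁ c₂ ,
  λ a b a< b< → trans (e₁ a b a< b<) (e₂ a b (subst (a <_) r₁ a<) (subst (b <_) c₁ b<))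

≋-ᵗ : ∀ {A B} → A ≋ B → A ᵗ ≋ B ᵗ
≋-ᵗ (r , c , e) = c , r , λ a b a< b< → e b a b< a<

lookup≤last : ∀ {r} (I : Vec ℕ (suc r)) →
              (∀ (k : Fin r) → lookup I (inject₁ k) ≤ lookup I (fsuc k)) →
              ∀ k → lookup I k ≤ lookup I (fromℕ r)
lookup≤last {0}     (x ∷ [])     mono fzero    = ≤-refl
lookup≤last {suc r} (x ∷ y ∷ I) mono fzero    =
  ≤-trans (mono fzero) (lookup≤last (y ∷ I) (mono ∘ fsuc) fzero)
lookup≤last {suc r} (x ∷ y ∷ I) mono (fsuc k) = lookup≤last (y ∷ I) (mono ∘ fsuc) k

IsBreaks⇒≤ : ∀ {r n} I → IsBreaks r n I → ∀ k → lookup I k ≤ n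
IsBreaks⇒≤ I (_ , last≡n , mono) k = subst (lookup I k ≤_) last≡n (lookup≤last I mono k)

IsPerm-ᵗ : ∀ {P} → IsPerm P → IsPerm (P ᵗ)
IsPerm-ᵗ (square , rows , cols) = sym square , cols , rows

IsPerm⇒row-unique : ∀ {P} → IsPerm P → ∀ {a b b'} → a < nr P → b < nc P → b' < nc P →
                    ent P a b ≡ true → ent P a b' ≡ true → b ≡ b'
IsPerm⇒row-unique (_ , rows , _) {a} {b} {b'} a< b< b'< e e' with rows a a<
... | _ , _ , _ , unique = trans (unique b b< e) (sym (unique b' b'< e'))

BlockOK-ᵗ : ∀ σ {P} → IsPerm P → ∀ {i i' j j'} → i' ≤ nr P → j' ≤ nc P →
            BlockOK σ P i i' j j' → BlockOK σ (P ᵗ) j j' i i'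
BlockOK-ᵗ s0 _ _ _ empty a b ja aj' ib bi' = empty b a ib bi' ja aj'
BlockOK-ᵗ s+ perm i'≤ j'≤ incr a b a' b' ja aj' ib bi' ja' a'j' ib' b'i' a<a' e e' with <-cmp b b'
... | tri< b<b' _ _ = b<b'
... | tri≈ _ refl _ = ⊥-elim (<-irrefl (IsPerm⇒row-unique perm (<-≤-trans bi' i'≤)
                        (<-≤-trans aj' j'≤) (<-≤-trans a'j' j'≤) e e') a<a')
... | tri> _ _ b'<b = ⊥-elim (<-asym a<a' (incr b' a' b a ib' b'i' ja' a'j' ib bi' ja aj' b'<b e' e))
BlockOK-ᵗ s- perm i'≤ j'≤ decr a b a' b' ja aj' ib bi' ja' a'j' ib' b'i' a<a' e e' with <-cmp b b'
... | tri< b<b' _ _ = ⊥-elim (<-asym a<a' (decr b a b' a' ib bi' ja aj' ib' b'i' ja' a'j' b<b' e e'))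
... | tri≈ _ refl _ = ⊥-elim (<-irrefl (IsPerm⇒row-unique perm (<-≤-trans bi' i'≤)
                        (<-≤-trans aj' j'≤) (<-≤-trans a'j' j'≤) e e') a<a')
... | tri> _ _ b'<b = b'<b

Part-transpose : ∀ {r s} {M : SMat r s} → Part (transpose M) → Part M
Part-transpose {r} {s} {M} (part P perm I J Iok Jok Mok) =
  part (P ᵗ) (IsPerm-ᵗ perm) J I
       (subst (λ n → IsBreaks r n J) square Jok)
       (subst (λ n → IsBreaks s n I) square Iok)
       (λ k ℓ → BlockOK-ᵗ (M k ℓ) perm (IsBreaks⇒≤ I Iok (fsuc ℓ))
                  (subst (lookup J (fsuc k) ≤_) square (IsBreaks⇒≤ J Jok (fsuc k))) (Mok ℓ k))
  where square = proj₁ perm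

Part-transpose-cong : ∀ {r s} {M : SMat r s} {x y : Part (transpose M)} →
                      x ≈ₚ y → Part-transpose x ≈ₚ Part-transpose y
Part-transpose-cong (P≋ , I≡ , J≡) = ≋-ᵗ P≋ , J≡ , I≡

Part-transpose-involutive : ∀ {r s} {M : SMat r s} (x : Part M) →
                            Part-transpose (Part-transpose x) ≈ₚ x
Part-transpose-involutive _ = ≋-refl , refl , refl

module _ {A : Set} where

  filterᵇ-cong : {f g : A → Bool} → f ≗ g → filterᵇ f ≗ filterᵇ g
  filterᵇ-cong         f≗g []       = refl
  filterᵇ-cong {f} {g} f≗g (x ∷ xs) with f x | g x | f≗g x
  ... | true  | .true  | refl = cong (x ∷_) (filterᵇ-cong f≗g xs)
  ... | false | .false | refl = filterᵇ-cong f≗g xs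

  any-cong : {f g : A → Bool} → f ≗ g → any f ≗ any g
  any-cong f≗g xs = cong or (map-cong f≗g xs)

  countᵇ : (A → Bool) → List A → ℕ
  countᵇ f xs = length (filterᵇ f xs)

  countᵇ-cong : {f g : A → Bool} → f ≗ g → countᵇ f ≗ countᵇ g
  countᵇ-cong f≗g xs = cong length (filterᵇ-cong f≗g xs)

  countᵇ-++ : ∀ (f : A → Bool) xs ys → countᵇ f (xs ++ ys) ≡ countᵇ f xs + countᵇ f ys
  countᵇ-++ f xs ys = trans (cong length (filter-++ (T? ∘ f) xs ys)) (length-++ (filterᵇ f xs))

  countᵇ-filterᵇ : ∀ (g h : A → Bool) xs →
                   countᵇ g (filterᵇ h xs) ≡ countᵇ (λ x → h x ∧ g x) xs
  countᵇ-filterᵇ g h []       = refl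
  countᵇ-filterᵇ g h (x ∷ xs) with h x
  ... | false = countᵇ-filterᵇ g h xs
  ... | true with g x
  ...   | true  = cong suc (countᵇ-filterᵇ g h xs)
  ...   | false = countᵇ-filterᵇ g h xs

countᵇ-map : ∀ {A B : Set} (f : B → Bool) (g : A → B) xs →
             countᵇ f (map g xs) ≡ countᵇ (f ∘ g) xs
countᵇ-map f g []       = refl
countᵇ-map f g (x ∷ xs) with f (g x)
... | true  = cong suc (countᵇ-map f g xs)
... | false = countᵇ-map f g xs

module _ {A B : Set} (f : A × B → Bool) where
  open ≡-Reasoning

  countᵇ-×-consˡ : ∀ x xs ys → countᵇ f (cartesianProduct (x ∷ xs) ys)
                               ≡ countᵇ (λ y → f (x , y)) ys + countᵇ f (cartesianProduct xs ys)
  countᵇ-×-consˡ x xs ys = begin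
    countᵇ f (map (x ,_) ys ++ cartesianProduct xs ys)
      ≡⟨ countᵇ-++ f (map (x ,_) ys) (cartesianProduct xs ys) ⟩
    countᵇ f (map (x ,_) ys) + countᵇ f (cartesianProduct xs ys)
      ≡⟨ cong (_+ countᵇ f (cartesianProduct xs ys)) (countᵇ-map f (x ,_) ys) ⟩
    countᵇ (λ y → f (x , y)) ys + countᵇ f (cartesianProduct xs ys) ∎

  countᵇ-×-consʳ : ∀ xs y ys → countᵇ f (cartesianProduct xs (y ∷ ys))
                               ≡ countᵇ (λ x → f (x , y)) xs + countᵇ f (cartesianProduct xs ys)
  countᵇ-×-consʳ []       y ys = refl
  countᵇ-×-consʳ (x ∷ xs) y ys = begin
    countᵇ f (cartesianProduct (x ∷ xs) (y ∷ ys))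
      ≡⟨ countᵇ-×-consˡ x xs (y ∷ ys) ⟩
    countᵇ fˣ (y ∷ ys) + countᵇ f (cartesianProduct xs (y ∷ ys))
      ≡⟨ cong₂ _+_ (countᵇ-++ fˣ [ y ] ys) (countᵇ-×-consʳ xs y ys) ⟩
    (countᵇ fˣ [ y ] + countᵇ fˣ ys) + (countᵇ fʸ xs + countᵇ f (cartesianProduct xs ys))
      ≡⟨ interchange (countᵇ fˣ [ y ]) (countᵇ fˣ ys) (countᵇ fʸ xs) _ ⟩
    (countᵇ fˣ [ y ] + countᵇ fʸ xs) + (countᵇ fˣ ys + countᵇ f (cartesianProduct xs ys))
      ≡⟨ cong₂ _+_ (trans (cong (_+ countᵇ fʸ xs) singleton) (sym (countᵇ-++ fʸ [ x ] xs)))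
                   (sym (countᵇ-×-consˡ x xs ys)) ⟩
    countᵇ fʸ (x ∷ xs) + countᵇ f (cartesianProduct (x ∷ xs) ys) ∎
    where
    fˣ = λ y → f (x , y)
    fʸ = λ x → f (x , y)
    singleton : countᵇ fˣ [ y ] ≡ countᵇ fʸ [ x ]
    singleton with f (x , y)
    ... | true  = refl
    ... | false = refl

countᵇ-×-swap : ∀ {A B : Set} (f : A × B → Bool) xs ys →
                countᵇ f (cartesianProduct xs ys) ≡ countᵇ (f ∘ swap) (cartesianProduct ys xs)
countᵇ-×-swap f []       ys = sym (cong (countᵇ (f ∘ swap)) (cartesianProductWith-zeroʳ _,_ ys))
countᵇ-×-swap f (x ∷ xs) ys =
  trans (countᵇ-×-consˡ f x xs ys)
        (trans (cong (countᵇ (λ y → f (x , y)) ys +_) (countᵇ-×-swap f xs ys))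
               (sym (countᵇ-×-consʳ (f ∘ swap) ys x xs)))

inBox : (i i' j j' : ℕ) → Pos → Bool
inBox i i' j j' (a , b) = (i ≤ᵇ a) ∧ (a <ᵇ i') ∧ (j ≤ᵇ b) ∧ (b <ᵇ j')

inBox-swap : ∀ i i' j j' p → inBox i i' j j' (swap p) ≡ inBox j j' i i' p
inBox-swap i i' j j' (a , b) = begin
  u ∧ v ∧ x ∧ y     ≡⟨ sym (∧-assoc u v (x ∧ y)) ⟩
  (u ∧ v) ∧ x ∧ y   ≡⟨ ∧-comm (u ∧ v) (x ∧ y) ⟩
  (x ∧ y) ∧ u ∧ v   ≡⟨ ∧-assoc x y (u ∧ v) ⟩
  x ∧ y ∧ u ∧ v     ∎
  where
  open ≡-Reasoning
  u = i ≤ᵇ b; v = b <ᵇ i'; x = j ≤ᵇ a; y = a <ᵇ j'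

entAt : Mat → Pos → Bool
entAt P (a , b) = ent P a b

countIn-map-swap : ∀ i i' j j' L → countIn i i' j j' (map swap L) ≡ countIn j j' i i' L
countIn-map-swap i i' j j' L =
  trans (countᵇ-map (inBox i i' j j') swap L) (countᵇ-cong (inBox-swap i i' j j') L)

countIn-supp-ᵗ : ∀ P i i' j j' → countIn j j' i i' (supp (P ᵗ)) ≡ countIn i i' j j' (supp P)
countIn-supp-ᵗ P i i' j j' = begin
  countIn j j' i i' (supp (P ᵗ))
    ≡⟨ countᵇ-filterᵇ (inBox j j' i i') (entAt P ∘ swap) (cartesianProduct cols rows) ⟩
  countᵇ (λ p → entAt P (swap p) ∧ inBox j j' i i' p) (cartesianProduct cols rows)
    ≡⟨ countᵇ-×-swap _ cols rows ⟩
  countᵇ (λ p → entAt P p ∧ inBox j j' i i' (swap p)) (cartesianProduct rows cols)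
    ≡⟨ countᵇ-cong (λ p → cong (entAt P p ∧_) (inBox-swap j j' i i' p)) (cartesianProduct rows cols) ⟩
  countᵇ (λ p → entAt P p ∧ inBox i i' j j' p) (cartesianProduct rows cols)
    ≡⟨ sym (countᵇ-filterᵇ (inBox i i' j j') (entAt P) (cartesianProduct rows cols)) ⟩
  countIn i i' j j' (supp P) ∎
  where
  open ≡-Reasoning
  rows = upTo (nr P)
  cols = upTo (nc P)

supp-ᵗ : ∀ P {p} → p ∈ supp P → swap p ∈ supp (P ᵗ)
supp-ᵗ P p∈ =
  let p∈rows×cols , p-nonzero = ∈-filter⁻ (T? ∘ entAt P) {xs = cartesianProduct rows cols} p∈
      a∈ , b∈ = ∈-cartesianProduct⁻ rows cols p∈rows×cols
  in ∈-filter⁺ (T? ∘ entAt P ∘ swap) (∈-cartesianProduct⁺ b∈ a∈) p-nonzero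
  where
  rows = upTo (nr P)
  cols = upTo (nc P)

_≗ₘ_ : Mat → Mat → Set
Q ≗ₘ Q' = nr Q ≡ nr Q' × nc Q ≡ nc Q' × (∀ a b → ent Q a b ≡ ent Q' a b)

red-cong : ∀ {Q Q'} → Q ≗ₘ Q' → red Q ≋ red Q'
red-cong {mat n m f} {mat _ _ g} (refl , refl , f≗g) =
  cong length rows≡ , cong length cols≡ ,
  λ a b _ _ → trans (f≗g _ _) (cong₂ (λ R C → g (nth R a) (nth C b)) rows≡ cols≡)
  where
  rows≡ : filterᵇ (λ a → any (f a) (upTo m)) (upTo n)
        ≡ filterᵇ (λ a → any (g a) (upTo m)) (upTo n)
  rows≡ = filterᵇ-cong (λ a → any-cong (f≗g a) (upTo m)) (upTo n)
  cols≡ : filterᵇ (λ b → any (λ a → f a b) (upTo n)) (upTo m)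
        ≡ filterᵇ (λ b → any (λ a → g a b) (upTo n)) (upTo m)
  cols≡ = filterᵇ-cong (λ b → any-cong (λ a → f≗g a b) (upTo n)) (upTo m)

-- Definitional: the nonzero rows of Qᵗ unfold to the nonzero columns of Q.
red-ᵗ : ∀ Q → red (Q ᵗ) ≋ red Q ᵗ
red-ᵗ Q = ≋-refl

Δ-map-swap : ∀ X → Δ (map swap X) ≗ₘ Δ X ᵗ
Δ-map-swap []            = refl , refl , λ _ _ → refl
Δ-map-swap ((a , b) ∷ X) with Δ-map-swap X
... | r , c , e = cong (suc b ⊔_) r , cong (suc a ⊔_) c ,
                  λ a' b' → cong₂ _∨_ (∧-comm (b ≡ᵇ a') (a ≡ᵇ b')) (e a' b')

red-Δ-map-swap : ∀ X → red (Δ (map swap X)) ≋ red (Δ X) ᵗ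
red-Δ-map-swap X = ≋-trans (red-cong (Δ-map-swap X)) (red-ᵗ (Δ X))

≼-transpose : ∀ {r s} {M : SMat r s} (y x : Part (transpose M)) →
              y ≼ x → Part-transpose {M = M} y ≼ Part-transpose x
≼-transpose y x (X , unique , X⊆supp , redΔX≋ , counts) =
  map swap X ,
  map⁺ (cong swap) unique ,
  All.map⁺ (All.map (supp-ᵗ (P x)) X⊆supp) ,
  ≋-trans (red-Δ-map-swap X) (≋-ᵗ redΔX≋) ,
  λ k ℓ → trans (countIn-map-swap (lo (J x) k) (hi (J x) k) (lo (I x) ℓ) (hi (I x) ℓ) X)
                (trans (counts ℓ k)
                       (sym (countIn-supp-ᵗ (P y) (lo (I y) ℓ) (hi (I y) ℓ) (lo (J y) k) (hi (J y) k))))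
  where
  lo hi : ∀ {n} → Vec ℕ (suc n) → Fin n → ℕ
  lo I k = lookup I (inject₁ k)
  hi I k = lookup I (fsuc k)

proposition3p1 : (r s : ℕ) (M : SMat r s) →
    OrderIso (_≈ₚ_ {M = transpose M}) (_≼_ {M = transpose M}) (_≈ₚ_ {M = M}) (_≼_ {M = M})
proposition3p1 r s M = record
  { to        = Part-transpose
  ; from      = Part-transpose
  ; to-cong   = λ {x} {y} → Part-transpose-cong {x = x} {y}
  ; from-cong = λ {x} {y} → Part-transpose-cong {x = x} {y}
  ; from-to   = Part-transpose-involutive
  ; to-from   = Part-transpose-involutive
  ; to-mono   = ≼-transpose
  ; to-refl   = λ y x → ≼-transpose (Part-transpose y) (Part-transpose x)
  }
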